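{- Let $\varphi$ be a $\mathrm{D}$-formula, $A$ a $\varphi$-atom, and $row,row'$ $\varphi$-rows with $row\sim row'$. Then $succ_\varphi(row,A)\sim succ_\varphi(row',A)$.
   Context: Formulas: $\varphi ::= p\mid\neg\varphi\mid\varphi\vee\varphi\mid\langle D\rangle\varphi$, $p\in\mathcal{AP}$; $[D]\psi:=\neg\langle D\rangle\neg\psi$. $\mathrm{CL}(\varphi)$: subformulas and their negations, identifying $\neg\neg\psi$ with $\psi$ and $\neg\langle D\rangle\psi$ with $[D]\neg\psi$. A $\varphi$-atom is $A\subseteq\mathrm{CL}(\varphi)$ with $\psi\in A$ iff $\neg\psi\notin A$, and $\psi_1\vee\psi_2\in A$ iff $\psi_1\in A$ or $\psi_2\in A$. $\mathcal{R}eq_D(A)=\{\psi:\langle D\rangle\psi\in A\}$, $\mathrm{REQ}_\varphi=\{\psi:\langle D\rangle\psi\in\mathrm{CL}(\varphi)\}$, $\mathcal{O}bs_D(A)=A\cap\mathrm{REQ}_\varphi$, $rank(A)=|\mathrm{REQ}_\varphi|-|\mathcal{R}eq_D(A)|$. $A\,D_\varphi\,A'$ iff for every $[D]\psi\in A$, $\psi\in A'$ and $[D]\psi\in A'$. $A_1A_2\Rightarrow A_3$ iff $A_3\cap\mathcal{AP}=A_1\cap A_2\cap\mathcal{AP}$ and $\mathcal{R}eq_D(A_3)=\mathcal{R}eq_D(A_1)\cup\mathcal{R}eq_D(A_2)\cup\mathcal{O}bs_D(A_1)\cup\mathcal{O}bs_D(A_2)$. A $\varphi$-row is a nonempty finite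 sequence $row[0]\cdots row[k-1]$ of atoms with $row[i+1]\,D_\varphi\,row[i]$ and $row[i]\cap\mathcal{AP}\supseteq row[i+1]\cap\mathcal{AP}$; its maximal factorization is $A_0^{m_0}\cdots A_n^{m_n}$ ($m_i>0$, $A_i\ne A_{i+1}$). Two rows are equivalent, $\sim$, iff their maximal factorizations $A_0^{m_0}\cdots A_n^{m_n}$ and $\hat A_0^{\hat m_0}\cdots\hat A_{\hat n}^{\hat m_{\hat n}}$ satisfy $n=\hat n$ and for each $i$, $A_i=\hat A_i$ and either $m_i=\hat m_i$ or both $m_i,\hat m_i>rank(A_i)$. For a row of length $n$ and an atom $A$, $succ_\varphi(row,A)=B_0\cdots B_n$ with $B_0=A$ and $row[i]B_i\Rightarrow B_{i+1}$ for $i\in[0,n-1]$. -}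

module Defs where

open import Data.Nat using (ℕ; zero; suc; _<_; _∸_)
open import Data.Nat.Properties using () renaming (_≟_ to _≟ℕ_)
open import Data.Bool using (Bool; true; false; _∧_; _∨_)
open import Data.List using (List; []; _∷_; concatMap; mapMaybe; deduplicate; filter; length; replicate)
open import Data.Bool.ListAction using (any)
open import Data.List.Membership.Propositional using (_∈_)
open import Data.List.Relation.Unary.All using (All)
open import Data.List.Relation.Unary.Linked using (Linked)
open import Data.List.Relation.Binary.Pointwise using (Pointwise)
open import Data.Maybe using (Maybe; just; nothing)
open import Data.Product using (Σ; _×_; _,_; proj₁; proj₂)
open import Data.Sum using (_⊎_)
open import Relation.Nullary using (¬_; Dec; yes; no; does)
open import Relation.Binary.PropositionalEquality using (_≡_; refl; cong; cong₂)
open import Function.Bundles using (_⇔_)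
open import Data.Bool.Properties using () renaming (_≟_ to _≟B_)

infixr 5 _∨f_
data Formula : Set where
  var  : ℕ → Formula
  neg  : Formula → Formula
  _∨f_ : Formula → Formula → Formula
  dia  : Formula → Formula

box : Formula → Formula
box ψ = neg (dia (neg ψ))

_≟F_ : (x y : Formula) → Dec (x ≡ y)
var p ≟F var q with p ≟ℕ q
... | yes refl = yes refl
... | no ne = no λ { refl → ne refl }
var _ ≟F neg _ = no λ ()
var _ ≟F (_ ∨f _) = no λ ()
var _ ≟F dia _ = no λ ()
neg _ ≟F var _ = no λ ()
neg x ≟F neg y with x ≟F y
... | yes refl = yes refl
... | no ne = no λ { refl → ne refl }
neg _ ≟F (_ ∨f _) = no λ ()
neg _ ≟F dia _ = no λ ()
(_ ∨f _) ≟F var _ = no λ ()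
(_ ∨f _) ≟F neg _ = no λ ()
(x₁ ∨f x₂) ≟F (y₁ ∨f y₂) with x₁ ≟F y₁ | x₂ ≟F y₂
... | yes refl | yes refl = yes refl
... | no ne | _ = no λ { refl → ne refl }
... | yes _ | no ne = no λ { refl → ne refl }
(_ ∨f _) ≟F dia _ = no λ ()
dia _ ≟F var _ = no λ ()
dia _ ≟F neg _ = no λ ()
dia _ ≟F (_ ∨f _) = no λ ()
dia x ≟F dia y with x ≟F y
... | yes refl = yes refl
... | no ne = no λ { refl → ne refl }

-- Identification ¬¬ψ = ψ (and hence ¬⟨D⟩ψ = [D]¬ψ): every formula is
-- represented by its normal form with all double negations removed.

negN : Formula → Formula
negN (var p)    = neg (var p)
negN (neg ψ)    = ψ
negN (ψ ∨f χ)   = neg (ψ ∨f χ)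
negN (dia ψ)    = neg (dia ψ)

nf : Formula → Formula
nf (var p)  = var p
nf (neg ψ)  = negN (nf ψ)
nf (ψ ∨f χ) = nf ψ ∨f nf χ
nf (dia ψ)  = dia (nf ψ)

subs : Formula → List Formula
subs (var p)  = var p ∷ []
subs (neg ψ)  = neg ψ ∷ subs ψ
subs (ψ ∨f χ) = (ψ ∨f χ) ∷ (subs ψ Data.List.++ subs χ)
subs (dia ψ)  = dia ψ ∷ subs ψ

CL : Formula → List Formula
CL φ = concatMap (λ χ → nf χ ∷ nf (neg χ) ∷ []) (subs φ)

diaArg : Formula → Maybe Formula
diaArg (dia ψ) = just ψ
diaArg _       = nothing

REQ : Formula → List Formula
REQ φ = deduplicate _≟F_ (mapMaybe diaArg (CL φ))

inREQ : Formula → Formula → Bool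
inREQ φ ψ = any (λ χ → does (ψ ≟F χ)) (REQ φ)

-- φ-atoms: subsets of CL(φ) (given by a characteristic function on
-- normal-form formulas) satisfying the two closure conditions.

record Atom (φ : Formula) : Set where
  field
    mem   : Formula → Bool
    ⊆CL   : ∀ ψ → mem ψ ≡ true → ψ ∈ CL φ
    compl : ∀ ψ → ψ ∈ CL φ → (mem ψ ≡ true) ⇔ (mem (nf (neg ψ)) ≡ false)
    disj  : ∀ ψ₁ ψ₂ → (ψ₁ ∨f ψ₂) ∈ CL φ →
            (mem (ψ₁ ∨f ψ₂) ≡ true) ⇔ (mem ψ₁ ≡ true ⊎ mem ψ₂ ≡ true)
open Atom public

module _ {φ : Formula} where

  _∈A_ : Formula → Atom φ → Set
  ψ ∈A A = mem A (nf ψ) ≡ true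

  _≈A_ : Atom φ → Atom φ → Set
  A ≈A B = ∀ ψ → mem A ψ ≡ mem B ψ

  ReqL : Atom φ → List Formula
  ReqL A = filter (λ ψ → mem A (dia ψ) ≟B true) (REQ φ)

  rank : Atom φ → ℕ
  rank A = length (REQ φ) ∸ length (ReqL A)

  _D⟶_ : Atom φ → Atom φ → Set
  A D⟶ A' = ∀ ψ → box ψ ∈A A → (ψ ∈A A') × (box ψ ∈A A')

  _⊇AP_ : Atom φ → Atom φ → Set
  A ⊇AP A' = ∀ p → mem A' (var p) ≡ true → mem A (var p) ≡ true

  Trans : Atom φ → Atom φ → Atom φ → Set
  Trans A₁ A₂ A₃ =
    (∀ p → mem A₃ (var p) ≡ (mem A₁ (var p) ∧ mem A₂ (var p))) ×
    -- Req_D(A₃) = Req_D(A₁) ∪ Req_D(A₂) ∪ Obs_D(A₁) ∪ Obs_D(A₂),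
    -- where Obs_D(A) = A ∩ REQ_φ
    (∀ ψ → mem A₃ (dia ψ) ≡
             (mem A₁ (dia ψ) ∨ mem A₂ (dia ψ) ∨
              (inREQ φ ψ ∧ mem A₁ ψ) ∨ (inREQ φ ψ ∧ mem A₂ ψ)))

  RowStep : Atom φ → Atom φ → Set
  RowStep a b = (b D⟶ a) × (a ⊇AP b)

  data NonEmpty {a} {X : Set a} : List X → Set a where
    nonEmpty : ∀ {x xs} → NonEmpty (x ∷ xs)

  IsRow : List (Atom φ) → Set
  IsRow row = NonEmpty row × Linked RowStep row

  expand : List (Atom φ × ℕ) → List (Atom φ)
  expand = concatMap (λ am → replicate (proj₂ am) (proj₁ am))

  IsMaxFact : List (Atom φ) → List (Atom φ × ℕ) → Set
  IsMaxFact row fs =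
    All (λ am → 0 < proj₂ am) fs ×
    Linked (λ am bm → ¬ (proj₁ am ≈A proj₁ bm)) fs ×
    Pointwise _≈A_ (expand fs) row

  BlockMatch : Atom φ × ℕ → Atom φ × ℕ → Set
  BlockMatch (A , m) (Â , m̂) =
    A ≈A Â × (m ≡ m̂ ⊎ (rank A < m × rank Â < m̂))

  _∼_ : List (Atom φ) → List (Atom φ) → Set
  row ∼ row' = Σ (List (Atom φ × ℕ)) λ fs → Σ (List (Atom φ × ℕ)) λ fs' →
    IsMaxFact row fs × IsMaxFact row' fs' × Pointwise BlockMatch fs fs'

  data IsSucc : List (Atom φ) → Atom φ → List (Atom φ) → Set where
    done : ∀ {B} → IsSucc [] B (B ∷ [])
    step : ∀ {r rs B B' Bs} → Trans r B B' → IsSucc rs B' Bs →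
           IsSucc (r ∷ rs) B (B ∷ Bs)

{-# OPTIONS --safe #-}
module Submission where

-- Along a block R^m of a row, every successor atom has its propositions bounded by
-- those of R and can only gain ⟨D⟩-requests, so after the first step each step
-- either repeats the atom or strictly lowers its rank. The first successor already
-- has rank ≤ rank R, so a block with m > rank R ends in a constant stretch longer
-- than the rank of its atom, and two such blocks of different lengths yield
-- successor sequences differing only in the length of that stretch; blocks of equal
-- length yield equal sequences because ⇒ is functional. Concatenating these
-- block-wise factorizations and merging adjacent blocks of equal atoms gives
-- maximal factorizations witnessing ∼.

open import Defs
open import Data.Bool using (true; false; not; _∧_; _∨_)
open import Data.Bool.Properties using (⇔→≡; ∧-zeroʳ; ∨-zeroʳ; ∧-conicalˡ) renaming (_≟_ to _≟B_)
open import Data.Empty using (⊥-elim)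
open import Data.List using (List; []; _∷_; _++_; replicate; length)
open import Data.List.Properties using (length-filter; concatMap-++; ++-identityʳ)
open import Data.List.Membership.Propositional using (_∈_)
open import Data.List.Membership.Propositional.Properties using (∈-filter⁺; ∈-filter⁻; ∈-deduplicate⁺)
open import Data.List.Membership.DecPropositional _≟F_ using (_∈?_)
open import Data.List.Relation.Unary.All as All using (All; []; _∷_; all?)
import Data.List.Relation.Unary.All.Properties as Allₚ
open import Data.List.Relation.Unary.Any.Properties using (gmap; mapMaybe⁺)
open import Data.List.Relation.Unary.Linked using (Linked; []; [-]; _∷_)
open import Data.List.Relation.Binary.Pointwise as Pw using (Pointwise; []; _∷_; Pointwise-≡⇒≡)
open import Data.List.Relation.Binary.Sublist.Propositional using (_⊆_; ⊆-refl)
open import Data.List.Relation.Binary.Sublist.Propositional.Properties using (filter⁺; length-mono-≤; to-≋)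
open import Data.Maybe.Relation.Unary.Any using (just)
open import Data.Nat using (ℕ; zero; suc; _+_; _<_; _≤_; z≤n; s≤s; s≤s⁻¹)
open import Data.Nat.Properties
  using (≤-antisym; ≤-trans; <-≤-trans; ≤∧≢⇒<; ∸-monoʳ-≤; ∸-monoʳ-<; m≤m+n; m≤n+m; n≮0)
open import Data.Product as Product using (Σ; ∃₂; _×_; _,_; proj₁; proj₂)
open import Data.Sum as Sum using (_⊎_; inj₁; inj₂)
open import Function.Bundles using (_⇔_; mk⇔; Equivalence)
open import Relation.Binary.Structures using (IsEquivalence)
open import Relation.Nullary using (¬_; Dec; yes; no)
open import Relation.Nullary.Decidable using (map′)
open import Relation.Binary.PropositionalEquality using (_≡_; refl; sym; trans; cong; cong₂; subst)

data Normal : Formula → Set where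
  var      : ∀ {p} → Normal (var p)
  neg-var  : ∀ {p} → Normal (neg (var p))
  _∨f_     : ∀ {a b} → Normal a → Normal b → Normal (a ∨f b)
  neg-∨f   : ∀ {a b} → Normal a → Normal b → Normal (neg (a ∨f b))
  dia      : ∀ {a} → Normal a → Normal (dia a)
  neg-dia  : ∀ {a} → Normal a → Normal (neg (dia a))

negN-Normal : ∀ {ψ} → Normal ψ → Normal (negN ψ)
negN-Normal var          = neg-var
negN-Normal neg-var      = var
negN-Normal (a ∨f b)     = neg-∨f a b
negN-Normal (neg-∨f a b) = a ∨f b
negN-Normal (dia a)      = neg-dia a
negN-Normal (neg-dia a)  = dia a

nf-Normal : ∀ ψ → Normal (nf ψ)
nf-Normal (var p)  = var
nf-Normal (neg ψ)  = negN-Normal (nf-Normal ψ)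
nf-Normal (ψ ∨f χ) = nf-Normal ψ ∨f nf-Normal χ
nf-Normal (dia ψ)  = dia (nf-Normal ψ)

nf-Normal-id : ∀ {ψ} → Normal ψ → nf ψ ≡ ψ
nf-Normal-id var          = refl
nf-Normal-id neg-var      = refl
nf-Normal-id (a ∨f b)     = cong₂ _∨f_ (nf-Normal-id a) (nf-Normal-id b)
nf-Normal-id (neg-∨f a b) = cong₂ (λ x y → neg (x ∨f y)) (nf-Normal-id a) (nf-Normal-id b)
nf-Normal-id (dia a)      = cong dia (nf-Normal-id a)
nf-Normal-id (neg-dia a)  = cong (λ x → neg (dia x)) (nf-Normal-id a)

CL-Normal : ∀ {φ ψ} → ψ ∈ CL φ → Normal ψ
CL-Normal {φ} = All.lookup (Allₚ.concat⁺ (Allₚ.map⁺ (All.tabulate {xs = subs φ}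
                  λ {χ} _ → nf-Normal χ ∷ nf-Normal (neg χ) ∷ [])))

nf-neg-neg-CL : ∀ {φ χ} → neg χ ∈ CL φ → nf (neg (neg χ)) ≡ χ
nf-neg-neg-CL {φ} {χ} m = cong negN (nf-Normal-id (CL-Normal {φ} m))

dia∈CL⇒∈REQ : ∀ {φ ψ} → dia ψ ∈ CL φ → ψ ∈ REQ φ
dia∈CL⇒∈REQ {φ} m = ∈-deduplicate⁺ _≟F_ (mapMaybe⁺ diaArg (CL φ) (gmap (λ { refl → just refl }) m))

≡true⇔≡false⇒≡not : ∀ {x y} → (x ≡ true ⇔ y ≡ false) → x ≡ not y
≡true⇔≡false⇒≡not {true}  {true}  h = Equivalence.to h refl
≡true⇔≡false⇒≡not {true}  {false} h = refl
≡true⇔≡false⇒≡not {false} {true}  h = refl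
≡true⇔≡false⇒≡not {false} {false} h = Equivalence.from h refl

≡true⇔⊎⇒≡∨ : ∀ {x y z} → (x ≡ true ⇔ (y ≡ true ⊎ z ≡ true)) → x ≡ y ∨ z
≡true⇔⊎⇒≡∨ {true}  {true}          h = refl
≡true⇔⊎⇒≡∨ {true}  {false} {true}  h = refl
≡true⇔⊎⇒≡∨ {true}  {false} {false} h with Equivalence.to h refl
... | inj₁ ()
... | inj₂ ()
≡true⇔⊎⇒≡∨ {false} {true}          h = Equivalence.from h (inj₁ refl)
≡true⇔⊎⇒≡∨ {false} {false} {true}  h = Equivalence.from h (inj₂ refl)
≡true⇔⊎⇒≡∨ {false} {false} {false} h = refl

module _ {φ : Formula} where

  -- _≈A_ and Trans unfold to Π- and Σ-types, from which Agda cannot recover their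
  -- atom arguments; wrapping them in records makes those arguments inferable.
  record _≃_ (A B : Atom φ) : Set where
    constructor ⟨_⟩
    field ≃⇒≈A : A ≈A B
  open _≃_ public

  record Step (R B C : Atom φ) : Set where
    constructor mkStep
    field isTrans : Trans R B C

  ≈A-isEquivalence : IsEquivalence (_≈A_ {φ})
  ≈A-isEquivalence = record
    { refl  = λ _ → refl
    ; sym   = λ e ψ → sym (e ψ)
    ; trans = λ e f ψ → trans (e ψ) (f ψ)
    }

  ≃-isEquivalence : IsEquivalence _≃_
  ≃-isEquivalence = record
    { refl  = ⟨ (λ _ → refl) ⟩
    ; sym   = λ { ⟨ e ⟩ → ⟨ (λ ψ → sym (e ψ)) ⟩ }
    ; trans = λ { ⟨ e ⟩ ⟨ f ⟩ → ⟨ (λ ψ → trans (e ψ) (f ψ)) ⟩ }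
    }

  private module ≈A-Pointwise = IsEquivalence (Pw.isEquivalence ≈A-isEquivalence)

  open IsEquivalence ≃-isEquivalence public
    using () renaming (refl to ≃-refl; sym to ≃-sym; trans to ≃-trans)

  mem-∉CL : (A : Atom φ) {ψ : Formula} → ¬ ψ ∈ CL φ → mem A ψ ≡ false
  mem-∉CL A {ψ} ψ∉CL with mem A ψ in eq
  ... | true  = ⊥-elim (ψ∉CL (⊆CL A ψ eq))
  ... | false = refl

  mem-≡-∉CL : (A B : Atom φ) {ψ : Formula} → ¬ ψ ∈ CL φ → mem A ψ ≡ mem B ψ
  mem-≡-∉CL A B ψ∉CL = trans (mem-∉CL A ψ∉CL) (sym (mem-∉CL B ψ∉CL))

  mem-neg : (A : Atom φ) {χ : Formula} → neg χ ∈ CL φ → mem A (neg χ) ≡ not (mem A χ)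
  mem-neg A {χ} m = ≡true⇔≡false⇒≡not
    (subst (λ ψ → (mem A (neg χ) ≡ true) ⇔ (mem A ψ ≡ false)) (nf-neg-neg-CL {φ} m) (compl A (neg χ) m))

  mem-∨f : (A : Atom φ) {ψ χ : Formula} → (ψ ∨f χ) ∈ CL φ → mem A (ψ ∨f χ) ≡ mem A ψ ∨ mem A χ
  mem-∨f A {ψ} {χ} m = ≡true⇔⊎⇒≡∨ (disj A ψ χ m)

  -- Away from CL φ both atoms are empty; inside it, negations and disjunctions
  -- are determined by their arguments.
  ≃-fromVarDia : (A B : Atom φ) → (∀ p → mem A (var p) ≡ mem B (var p)) →
                 (∀ ψ → mem A (dia ψ) ≡ mem B (dia ψ)) → A ≃ B
  ≃-fromVarDia A B agreeVar agreeDia = ⟨ agree ⟩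
    where
    agree : ∀ ψ → mem A ψ ≡ mem B ψ
    agree (var p) = agreeVar p
    agree (dia ψ) = agreeDia ψ
    agree (neg χ) with neg χ ∈? CL φ
    ... | yes m = trans (mem-neg A m) (trans (cong not (agree χ)) (sym (mem-neg B m)))
    ... | no m  = mem-≡-∉CL A B m
    agree (ψ ∨f χ) with (ψ ∨f χ) ∈? CL φ
    ... | yes m = trans (mem-∨f A m) (trans (cong₂ _∨_ (agree ψ) (agree χ)) (sym (mem-∨f B m)))
    ... | no m  = mem-≡-∉CL A B m

  _≃?_ : (A B : Atom φ) → Dec (A ≃ B)
  A ≃? B = map′ fromCL (λ A≃B → All.tabulate λ {ψ} _ → ≃⇒≈A A≃B ψ)
                (all? (λ ψ → mem A ψ ≟B mem B ψ) (CL φ))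
    where
    fromCL : All (λ ψ → mem A ψ ≡ mem B ψ) (CL φ) → A ≃ B
    fromCL agree = ⟨ agreeAll ⟩
      where
      agreeAll : ∀ ψ → mem A ψ ≡ mem B ψ
      agreeAll ψ with ψ ∈? CL φ
      ... | yes m = All.lookup agree m
      ... | no m  = mem-≡-∉CL A B m

  _⊆Req_ : Atom φ → Atom φ → Set
  A ⊆Req B = ∀ ψ → mem A (dia ψ) ≡ true → mem B (dia ψ) ≡ true

  ReqL-⊆ : {A B : Atom φ} → A ⊆Req B → ReqL A ⊆ ReqL B
  ReqL-⊆ {A} {B} A⊆B = filter⁺ (λ ψ → mem A (dia ψ) ≟B true) (λ ψ → mem B (dia ψ) ≟B true)
                               (λ { refl → A⊆B _ }) (⊆-refl {x = REQ φ})

  length-ReqL-≡⇒⊇Req : {A B : Atom φ} → A ⊆Req B → length (ReqL A) ≡ length (ReqL B) → B ⊆Req A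
  length-ReqL-≡⇒⊇Req {A} {B} A⊆B eq ψ h =
    proj₂ (∈-filter⁻ (λ ψ → mem A (dia ψ) ≟B true) {xs = REQ φ}
      (subst (ψ ∈_) (sym (Pointwise-≡⇒≡ (to-≋ eq (ReqL-⊆ {A} {B} A⊆B))))
        (∈-filter⁺ (λ ψ → mem B (dia ψ) ≟B true) (dia∈CL⇒∈REQ {φ} (⊆CL B (dia ψ) h)) h)))

  rank-antitone : {A B : Atom φ} → A ⊆Req B → rank B ≤ rank A
  rank-antitone {A} {B} A⊆B = ∸-monoʳ-≤ (length (REQ φ)) (length-mono-≤ (ReqL-⊆ {A} {B} A⊆B))

  rank-strictlyAntitone : {A B : Atom φ} → A ⊆Req B → ¬ B ⊆Req A → rank B < rank A
  rank-strictlyAntitone {A} {B} A⊆B B⊈A =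
    ∸-monoʳ-< (≤∧≢⇒< (length-mono-≤ (ReqL-⊆ {A} {B} A⊆B))
                     (λ eq → B⊈A (length-ReqL-≡⇒⊇Req {A} {B} A⊆B eq)))
              (length-filter (λ ψ → mem B (dia ψ) ≟B true) (REQ φ))

  rank-resp-≃ : {A B : Atom φ} → A ≃ B → rank A ≡ rank B
  rank-resp-≃ {A} {B} ⟨ A≈B ⟩ = ≤-antisym (rank-antitone {B} {A} λ ψ → trans (A≈B (dia ψ)))
                                         (rank-antitone {A} {B} λ ψ → trans (sym (A≈B (dia ψ))))

  Step-resp : {R R' B B' C C' : Atom φ} → R ≃ R' → B ≃ B' → C ≃ C' → Step R B C → Step R' B' C'
  Step-resp ⟨ eR ⟩ ⟨ eB ⟩ ⟨ eC ⟩ (mkStep (transVar , transDia)) = mkStep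
    ((λ p → trans (sym (eC (var p)))
              (trans (transVar p) (cong₂ _∧_ (eR (var p)) (eB (var p))))) ,
     (λ ψ → trans (sym (eC (dia ψ)))
              (trans (transDia ψ)
                (cong₂ _∨_ (eR (dia ψ))
                  (cong₂ _∨_ (eB (dia ψ))
                    (cong₂ _∨_ (cong (inREQ φ ψ ∧_) (eR ψ)) (cong (inREQ φ ψ ∧_) (eB ψ))))))))

  Step-functional : {R B C C' : Atom φ} → Step R B C → Step R B C' → C ≃ C'
  Step-functional {C = C} {C'} (mkStep (transVar , transDia)) (mkStep (transVar' , transDia')) =
    ≃-fromVarDia C C' (λ p → trans (transVar p) (sym (transVar' p)))
                      (λ ψ → trans (transDia ψ) (sym (transDia' ψ)))

  Step-deterministic : {R R̂ B B̂ C Ĉ : Atom φ} → R ≃ R̂ → B ≃ B̂ → Step R B C → Step R̂ B̂ Ĉ → C ≃ Ĉ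
  Step-deterministic R≃R̂ B≃B̂ s ŝ = Step-functional (Step-resp R≃R̂ B≃B̂ ≃-refl s) ŝ

  Step-⊇AP : {R B C : Atom φ} → Step R B C → R ⊇AP C
  Step-⊇AP (mkStep (transVar , _)) p h = ∧-conicalˡ _ _ (trans (sym (transVar p)) h)

  Step-⊆Reqˡ : {R B C : Atom φ} → Step R B C → R ⊆Req C
  Step-⊆Reqˡ (mkStep (_ , transDia)) ψ h rewrite transDia ψ | h = refl

  Step-⊆Reqʳ : {R B C : Atom φ} → Step R B C → B ⊆Req C
  Step-⊆Reqʳ {R} (mkStep (_ , transDia)) ψ h rewrite transDia ψ | h = ∨-zeroʳ (mem R (dia ψ))

  Step-preservesAP : {R B C : Atom φ} → R ⊇AP B → Step R B C → ∀ p → mem C (var p) ≡ mem B (var p)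
  Step-preservesAP {R} {B} R⊇B (mkStep (transVar , _)) p with mem B (var p) in e
  ... | true  = trans (transVar p) (cong₂ _∧_ (R⊇B p e) e)
  ... | false = trans (transVar p) (trans (cong (mem R (var p) ∧_) e) (∧-zeroʳ (mem R (var p))))

  -- Req only grows along a step and the propositions stay put, so a step that
  -- changes the atom must strictly enlarge Req.
  rank-decreasing : {R B C : Atom φ} → R ⊇AP B → Step R B C → ¬ C ≃ B → rank C < rank B
  rank-decreasing {B = B} {C} R⊇B s C≄B =
    rank-strictlyAntitone {B} {C} (Step-⊆Reqʳ s) λ C⊆B →
      C≄B (≃-fromVarDia C B (Step-preservesAP R⊇B s)
                            (λ ψ → ⇔→≡ (mk⇔ (C⊆B ψ) (Step-⊆Reqʳ s ψ))))

  -- The final atom is recorded only up to ≃, so that the starting atom of a run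
  -- can be replaced by an equivalent one (Run-resp).
  data Run : List (Atom φ) → Atom φ → List (Atom φ) → Atom φ → Set where
    []  : ∀ {B E} → B ≃ E → Run [] B [] E
    _∷_ : ∀ {R row B C Cs E} → Step R B C → Run row C Cs E → Run (R ∷ row) B (C ∷ Cs) E

  IsSucc⇒Run : ∀ {row B Bs} → IsSucc row B Bs → ∃₂ λ Cs E → Bs ≡ B ∷ Cs × Run row B Cs E
  IsSucc⇒Run done = [] , _ , refl , [] ≃-refl
  IsSucc⇒Run (step t succ) with IsSucc⇒Run succ
  ... | Cs , E , refl , run = _ , E , refl , mkStep t ∷ run

  Run-++⁻ : ∀ row₁ {row₂ B Cs E} → Run (row₁ ++ row₂) B Cs E →
            Σ (List (Atom φ)) λ Cs₁ → ∃₂ λ Cs₂ M →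
              Cs ≡ Cs₁ ++ Cs₂ × Run row₁ B Cs₁ M × Run row₂ M Cs₂ E
  Run-++⁻ []         run       = [] , _ , _ , refl , [] ≃-refl , run
  Run-++⁻ (_ ∷ row₁) (s ∷ run) with Run-++⁻ row₁ run
  ... | Cs₁ , Cs₂ , M , refl , run₁ , run₂ = _ ∷ Cs₁ , Cs₂ , M , refl , s ∷ run₁ , run₂

  Run-resp : ∀ {row row' B B' Cs E} → Pointwise _≃_ row row' → B ≃ B' →
             Run row B Cs E → Run row' B' Cs E
  Run-resp []             B≃B' ([] B≃E) = [] (≃-trans (≃-sym B≃B') B≃E)
  Run-resp (R≃R' ∷ rows) B≃B' (s ∷ run) = Step-resp R≃R' B≃B' ≃-refl s ∷ Run-resp rows ≃-refl run

  Run-deterministic : ∀ {row B B̂ Cs Ĉs E Ê} → B ≃ B̂ →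
                      Run row B Cs E → Run row B̂ Ĉs Ê → Pointwise _≃_ Cs Ĉs × E ≃ Ê
  Run-deterministic B≃B̂ ([] B≃E) ([] B̂≃Ê) = [] , ≃-trans (≃-sym B≃E) (≃-trans B≃B̂ B̂≃Ê)
  Run-deterministic B≃B̂ (_∷_ {C = C} s run) (_∷_ {C = Ĉ} ŝ r̂un) =
    Product.map₁ (C≃Ĉ ∷_) (Run-deterministic C≃Ĉ run r̂un)
    where
    C≃Ĉ : C ≃ Ĉ
    C≃Ĉ = Step-deterministic ≃-refl B≃B̂ s ŝ

  Positive : Atom φ × ℕ → Set
  Positive am = 0 < proj₂ am

  Distinct : Atom φ × ℕ → Atom φ × ℕ → Set
  Distinct am bm = ¬ (proj₁ am ≈A proj₁ bm)

  IsWeakFact : List (Atom φ) → List (Atom φ × ℕ) → Set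
  IsWeakFact row fs = All Positive fs × Pointwise _≈A_ (expand fs) row

  _≋_ : List (Atom φ) → List (Atom φ) → Set
  row ≋ row' = ∃₂ λ fs fs' → IsWeakFact row fs × IsWeakFact row' fs' × Pointwise BlockMatch fs fs'

  ≋-[] : [] ≋ []
  ≋-[] = [] , [] , ([] , []) , ([] , []) , []

  ≋-block : ∀ {A Â m m̂ row row'} → BlockMatch (A , m) (Â , m̂) → 0 < m → 0 < m̂ →
            Pointwise _≃_ (replicate m A) row → Pointwise _≃_ (replicate m̂ Â) row' → row ≋ row'
  ≋-block {A} {Â} {m} {m̂} match m>0 m̂>0 row≃ row'≃ =
    (A , m) ∷ [] , (Â , m̂) ∷ [] , (m>0 ∷ [] , single row≃) , (m̂>0 ∷ [] , single row'≃) , match ∷ []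
    where
    single : ∀ {n B row} → Pointwise _≃_ (replicate n B) row → Pointwise _≈A_ (replicate n B ++ []) row
    single {n} {B} p =
      subst (λ xs → Pointwise _≈A_ xs _) (sym (++-identityʳ (replicate n B))) (Pw.map ≃⇒≈A p)

  IsWeakFact-++ : ∀ {row row' fs fs'} → IsWeakFact row fs → IsWeakFact row' fs' →
                  IsWeakFact (row ++ row') (fs ++ fs')
  IsWeakFact-++ {fs = fs} {fs'} (pos , e) (pos' , e') =
    Allₚ.++⁺ pos pos' ,
    subst (λ xs → Pointwise _≈A_ xs _) (sym (concatMap-++ _ fs fs')) (Pw.++⁺ e e')

  ≋-++ : ∀ {xs ys xs' ys'} → xs ≋ ys → xs' ≋ ys' → (xs ++ xs') ≋ (ys ++ ys')
  ≋-++ (fs , gs , wf , wg , match) (fs' , gs' , wf' , wg' , match') =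
    fs ++ fs' , gs ++ gs' , IsWeakFact-++ wf wf' , IsWeakFact-++ wg wg' , Pw.++⁺ match match'

  ≋-∷ : ∀ {A Â row row'} → A ≃ Â → row ≋ row' → (A ∷ row) ≋ (Â ∷ row')
  ≋-∷ A≃Â = ≋-++ (≋-block (≃⇒≈A A≃Â , inj₁ refl) (s≤s z≤n) (s≤s z≤n) (≃-refl ∷ []) (≃-refl ∷ []))

  ≋-pointwise : ∀ {row row'} → Pointwise _≃_ row row' → row ≋ row'
  ≋-pointwise []          = ≋-[]
  ≋-pointwise (A≃Â ∷ row≃) = ≋-∷ A≃Â (≋-pointwise row≃)

  IsMaxFact-cons : ∀ {A m row gs} → 0 < m → Linked Distinct ((A , m) ∷ gs) → IsMaxFact row gs →
                   IsMaxFact (replicate m A ++ row) ((A , m) ∷ gs)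
  IsMaxFact-cons m>0 distinct (pos , _ , e) =
    m>0 ∷ pos , distinct , Pw.++⁺ ≈A-Pointwise.refl e

  IsMaxFact-merge : ∀ {A C m k row gs} → A ≃ C → IsMaxFact row ((C , k) ∷ gs) →
                    IsMaxFact (replicate m A ++ row) ((A , m + k) ∷ gs)
  IsMaxFact-merge {A} {C} {m} {k} {gs = gs} ⟨ A≈C ⟩ (k>0 ∷ pos , distinct , e) =
    <-≤-trans k>0 (m≤n+m k m) ∷ pos ,
    relink distinct ,
    ≈A-Pointwise.trans (split m) (Pw.++⁺ ≈A-Pointwise.refl e)
    where
    relink : Linked Distinct ((C , k) ∷ gs) → Linked Distinct ((A , m + k) ∷ gs)
    relink [-]             = [-]
    relink (C≉D ∷ linked) = (λ A≈D → C≉D (λ ψ → trans (sym (A≈C ψ)) (A≈D ψ))) ∷ linked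
    split : ∀ n → Pointwise _≈A_ (replicate (n + k) A ++ expand gs)
                                 (replicate n A ++ replicate k C ++ expand gs)
    split zero    = Pw.++⁺ (Pw.replicate⁺ A≈C k) ≈A-Pointwise.refl
    split (suc n) = (λ _ → refl) ∷ split n

  BlockMatch-merge : ∀ {A Â C Ĉ m m̂ k k̂} → A ≃ C → Â ≃ Ĉ →
                     BlockMatch (A , m) (Â , m̂) → BlockMatch (C , k) (Ĉ , k̂) →
                     BlockMatch (A , m + k) (Â , m̂ + k̂)
  BlockMatch-merge _ _ (A≈Â , inj₁ refl) (_ , inj₁ refl) = A≈Â , inj₁ refl
  BlockMatch-merge {m = m} {m̂} {k} {k̂} _ _ (A≈Â , inj₂ (A<m , Â<m̂)) _ =
    A≈Â , inj₂ (<-≤-trans A<m (m≤m+n m k) , <-≤-trans Â<m̂ (m≤m+n m̂ k̂))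
  BlockMatch-merge {m = m} {m̂} {k} {k̂} A≃C Â≃Ĉ (A≈Â , inj₁ _) (_ , inj₂ (C<k , Ĉ<k̂)) =
    A≈Â , inj₂ (<-≤-trans (subst (_< k) (sym (rank-resp-≃ A≃C)) C<k) (m≤n+m k m) ,
                <-≤-trans (subst (_< k̂) (sym (rank-resp-≃ Â≃Ĉ)) Ĉ<k̂) (m≤n+m k̂ m̂))

  ∼-cons : ∀ {A Â m m̂ xs ys} → A ≃ Â → BlockMatch (A , m) (Â , m̂) → 0 < m → 0 < m̂ →
           xs ∼ ys → (replicate m A ++ xs) ∼ (replicate m̂ Â ++ ys)
  ∼-cons A≃Â match m>0 m̂>0 ([] , [] , gs , gs' , []) =
    _ , _ , IsMaxFact-cons m>0 [-] gs , IsMaxFact-cons m̂>0 [-] gs' , match ∷ []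
  ∼-cons {A} {Â} A≃Â match m>0 m̂>0
         ((C , k) ∷ _ , (Ĉ , k̂) ∷ _ , gs@(_ , distinct , _) , gs'@(_ , distinct' , _) , match' ∷ matches)
    with A ≃? C
  ... | yes A≃C =
    _ , _ , IsMaxFact-merge A≃C gs , IsMaxFact-merge Â≃Ĉ gs' ,
    BlockMatch-merge A≃C Â≃Ĉ match match' ∷ matches
    where
    Â≃Ĉ : Â ≃ Ĉ
    Â≃Ĉ = ≃-trans (≃-sym A≃Â) (≃-trans A≃C ⟨ proj₁ match' ⟩)
  ... | no A≄C =
    _ , _ , IsMaxFact-cons m>0 ((λ A≈C → A≄C ⟨ A≈C ⟩) ∷ distinct) gs ,
    IsMaxFact-cons m̂>0 ((λ Â≈Ĉ → A≄C (≃-trans A≃Â (≃-trans ⟨ Â≈Ĉ ⟩ (≃-sym C≃Ĉ)))) ∷ distinct') gs' ,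
    match ∷ match' ∷ matches
    where
    C≃Ĉ : C ≃ Ĉ
    C≃Ĉ = ⟨ proj₁ match' ⟩

  maximise : ∀ {fs fs' : List (Atom φ × ℕ)} → All Positive fs → All Positive fs' →
             Pointwise BlockMatch fs fs' → expand fs ∼ expand fs'
  maximise [] [] [] = [] , [] , ([] , [] , []) , ([] , [] , []) , []
  maximise (m>0 ∷ pos) (m̂>0 ∷ pos') (_∷_ {x = A , _} {y = Â , _} match matches) =
    ∼-cons (⟨_⟩ {A} {Â} (proj₁ match)) match m>0 m̂>0 (maximise pos pos' matches)

  ∼-resp : ∀ {xs xs' ys ys' : List (Atom φ)} → Pointwise _≈A_ xs ys → Pointwise _≈A_ xs' ys' →
           xs ∼ xs' → ys ∼ ys'
  ∼-resp xs≈ys xs'≈ys' (gs , gs' , (pos , distinct , e) , (pos' , distinct' , e') , matches) =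
    gs , gs' , (pos , distinct , ≈A-Pointwise.trans e xs≈ys) ,
    (pos' , distinct' , ≈A-Pointwise.trans e' xs'≈ys') , matches

  ≋⇒∼ : ∀ {row row' : List (Atom φ)} → row ≋ row' → row ∼ row'
  ≋⇒∼ (fs , fs' , (pos , e) , (pos' , e') , matches) = ∼-resp e e' (maximise pos pos' matches)

  Fixed : Atom φ → Atom φ → Set
  Fixed R C = ∀ {N} → Step R C N → N ≃ C

  Fixed-byStep : ∀ {R C N} → Step R C N → N ≃ C → Fixed R C
  Fixed-byStep s N≃C s' = ≃-trans (Step-functional s' s) N≃C

  rank-zero-Fixed : ∀ {R C} → R ⊇AP C → rank C ≤ 0 → Fixed R C
  rank-zero-Fixed {C = C} R⊇C rankC≤0 {N} s with N ≃? C
  ... | yes N≃C = N≃C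
  ... | no N≄C  = ⊥-elim (n≮0 (<-≤-trans (rank-decreasing R⊇C s N≄C) rankC≤0))

  Run-Fixed : ∀ n {R C Cs E} → Fixed R C → Run (replicate n R) C Cs E →
              Pointwise _≃_ (replicate n C) Cs × E ≃ C
  Run-Fixed zero    fixed ([] C≃E)  = [] , ≃-sym C≃E
  Run-Fixed (suc n) fixed (s ∷ run) =
    Product.map₁ (≃-sym (fixed s) ∷_) (Run-Fixed n fixed (Run-resp (Pw.refl ≃-refl) (fixed s) run))

  runs-≋-fromFixed : ∀ n n̂ {R C Ĉ Cs Ĉs E Ê} → Fixed R C → C ≃ Ĉ → rank C ≤ n → rank C ≤ n̂ →
                     Run (replicate n R) C Cs E → Run (replicate n̂ R) Ĉ Ĉs Ê →
                     (C ∷ Cs) ≋ (Ĉ ∷ Ĉs) × E ≃ Ê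
  runs-≋-fromFixed n n̂ fixed C≃Ĉ rankC≤n rankC≤n̂ run r̂un
    with Run-Fixed n fixed run | Run-Fixed n̂ fixed (Run-resp (Pw.refl ≃-refl) (≃-sym C≃Ĉ) r̂un)
  ... | Cs≃ , E≃C | Ĉs≃ , Ê≃C =
    ≋-block ((λ _ → refl) , inj₂ (s≤s rankC≤n , s≤s rankC≤n̂)) (s≤s z≤n) (s≤s z≤n)
            (≃-refl ∷ Cs≃) (C≃Ĉ ∷ Ĉs≃) ,
    ≃-trans E≃C (≃-sym Ê≃C)

  -- Each step from C either stays at a fixed atom or lowers the rank, so rank C ≤ n, n̂
  -- leaves room for both runs to become constant.
  runs-≋-pastRank : ∀ n n̂ {R C Ĉ Cs Ĉs E Ê} → C ≃ Ĉ → R ⊇AP C → rank C ≤ n → rank C ≤ n̂ →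
                    Run (replicate n R) C Cs E → Run (replicate n̂ R) Ĉ Ĉs Ê →
                    (C ∷ Cs) ≋ (Ĉ ∷ Ĉs) × E ≃ Ê
  runs-≋-pastRank zero n̂ C≃Ĉ R⊇C rankC≤0 rankC≤n̂ =
    runs-≋-fromFixed 0 n̂ (rank-zero-Fixed R⊇C rankC≤0) C≃Ĉ rankC≤0 rankC≤n̂
  runs-≋-pastRank (suc n) zero C≃Ĉ R⊇C rankC≤n rankC≤0 =
    runs-≋-fromFixed (suc n) 0 (rank-zero-Fixed R⊇C rankC≤0) C≃Ĉ rankC≤n rankC≤0
  runs-≋-pastRank (suc n) (suc n̂) {C = C} C≃Ĉ R⊇C rankC≤n rankC≤n̂
                  run@(_∷_ {C = N} s run') r̂un@(ŝ ∷ r̂un') with N ≃? C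
  ... | yes N≃C = runs-≋-fromFixed (suc n) (suc n̂) (Fixed-byStep s N≃C) C≃Ĉ rankC≤n rankC≤n̂ run r̂un
  ... | no N≄C =
    Product.map₁ (≋-∷ C≃Ĉ)
      (runs-≋-pastRank n n̂ (Step-deterministic ≃-refl C≃Ĉ s ŝ) (Step-⊇AP s)
                       (rankN≤ rankC≤n) (rankN≤ rankC≤n̂) run' r̂un')
    where
    rankN≤ : ∀ {k} → rank C ≤ suc k → rank N ≤ k
    rankN≤ rankC≤1+k = s≤s⁻¹ (<-≤-trans (rank-decreasing R⊇C s N≄C) rankC≤1+k)

  runs-≋-sameBlock : ∀ m m̂ {R B B̂ Cs Ĉs E Ê} → m ≡ m̂ ⊎ (rank R < m × rank R < m̂) → B ≃ B̂ →
                     Run (replicate m R) B Cs E → Run (replicate m̂ R) B̂ Ĉs Ê → Cs ≋ Ĉs × E ≃ Ê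
  runs-≋-sameBlock m .m (inj₁ refl) B≃B̂ run r̂un =
    Product.map₁ ≋-pointwise (Run-deterministic B≃B̂ run r̂un)
  runs-≋-sameBlock zero    _       (inj₂ (() , _))
  runs-≋-sameBlock (suc _) zero    (inj₂ (_ , ()))
  runs-≋-sameBlock (suc m) (suc m̂) {R} (inj₂ (rankR<1+m , rankR<1+m̂)) B≃B̂
                   (_∷_ {C = C} s run) (ŝ ∷ r̂un) =
    runs-≋-pastRank m m̂ (Step-deterministic ≃-refl B≃B̂ s ŝ) (Step-⊇AP s)
                    (≤-trans rankC≤rankR (s≤s⁻¹ rankR<1+m)) (≤-trans rankC≤rankR (s≤s⁻¹ rankR<1+m̂))
                    run r̂un
    where
    rankC≤rankR : rank C ≤ rank R
    rankC≤rankR = rank-antitone {R} {C} (Step-⊆Reqˡ s)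

  runs-≋-block : ∀ {R R̂ m m̂ B B̂ Cs Ĉs E Ê} → R ≃ R̂ → m ≡ m̂ ⊎ (rank R < m × rank R̂ < m̂) →
                 B ≃ B̂ → Run (replicate m R) B Cs E → Run (replicate m̂ R̂) B̂ Ĉs Ê → Cs ≋ Ĉs × E ≃ Ê
  runs-≋-block {m = m} {m̂} R≃R̂ counts B≃B̂ run r̂un =
    runs-≋-sameBlock m m̂ (Sum.map₂ (Product.map₂ (subst (_< m̂) (sym (rank-resp-≃ R≃R̂)))) counts)
                     B≃B̂ run (Run-resp (Pw.replicate⁺ (≃-sym R≃R̂) m̂) ≃-refl r̂un)

  runs-≋-blocks : ∀ {fs fs' : List (Atom φ × ℕ)} {B B̂ Cs Ĉs E Ê} → Pointwise BlockMatch fs fs' →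
                  B ≃ B̂ → Run (expand fs) B Cs E → Run (expand fs') B̂ Ĉs Ê → Cs ≋ Ĉs × E ≃ Ê
  runs-≋-blocks [] B≃B̂ ([] B≃E) ([] B̂≃Ê) = ≋-[] , ≃-trans (≃-sym B≃E) (≃-trans B≃B̂ B̂≃Ê)
  runs-≋-blocks (_∷_ {x = R , m} {y = R̂ , m̂} (R≈R̂ , counts) matches) B≃B̂ run r̂un
    with Run-++⁻ (replicate m R) run | Run-++⁻ (replicate m̂ R̂) r̂un
  ... | _ , _ , _ , refl , run₁ , run₂ | _ , _ , _ , refl , r̂un₁ , r̂un₂
    with runs-≋-block (⟨_⟩ {R} {R̂} R≈R̂) counts B≃B̂ run₁ r̂un₁
  ... | block≋ , M≃M̂ = Product.map₁ (≋-++ block≋) (runs-≋-blocks matches M≃M̂ run₂ r̂un₂)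

lemma3p14 : (φ : Formula) (A : Atom φ) (row row' : List (Atom φ)) →
            IsRow row → IsRow row' → row ∼ row' →
            (Bs Bs' : List (Atom φ)) →
            IsSucc row A Bs → IsSucc row' A Bs' →
            Bs ∼ Bs'
lemma3p14 φ A row row' _ _ (_ , _ , (_ , _ , fs≈row) , (_ , _ , fs'≈row') , matches) _ _ succ succ'
  with IsSucc⇒Run succ | IsSucc⇒Run succ'
... | _ , _ , refl , run | _ , _ , refl , run' =
  ≋⇒∼ (≋-∷ ≃-refl (proj₁ (runs-≋-blocks matches ≃-refl (alongExpansion fs≈row run)
                                                       (alongExpansion fs'≈row' run'))))
  where
  alongExpansion : ∀ {xs row : List (Atom φ)} {B Cs E} → Pointwise _≈A_ xs row →
                   Run row B Cs E → Run xs B Cs E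
  alongExpansion xs≈row = Run-resp (Pw.symmetric ≃-sym (Pw.map ⟨_⟩ xs≈row)) ≃-refl
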